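{- Let $M=(E,\mathcal{B})$ be a matroid of rank $r$. If $\nu,\nu'\in\mathscr{D}(M)$ then $$D(\nu)=D(\nu')\Longleftrightarrow\nu\sim\nu'\Longleftrightarrow L([\nu])=L([\nu']).$$
   Context: For $\nu:\mathcal{B}\to\mathbb{R}$, $\overline{\nu}$ extends $\nu$ by $\infty$ outside $\mathcal{B}$; $\nu$ is a valuation of $M$ if for all $B,B'\in\binom{E}{r}$ and $e\in B\setminus B'$ there is $f\in B'\setminus B$ with $\overline{\nu}(B)+\overline{\nu}(B')\geq\overline{\nu}(B-e+f)+\overline{\nu}(B'+e-f)$; $\mathscr{D}(M)\subseteq\mathbb{R}^{\mathcal{B}}$ is the set of valuations. $Z(r,E)$ is the set of triples $(S,ab,cd)$ with $S\in\binom{E}{r-2}$, $a,b,c,d\in E\setminus S$ distinct, $Sab:=S\cup\{a,b\}$ etc.; $[\overline{\nu}]:=\{(S,ab,cd)\in Z(r,E):\overline{\nu}(Sac)+\overline{\nu}(Sbd)=\overline{\nu}(Sad)+\overline{\nu}(Sbc)\}$; $\nu\sim\nu'$ iff $[\overline{\nu}]=[\overline{\nu'}]$; $D(\nu):=\{\nu'\in\mathbb{R}^{\mathcal{B}}:\nu'\sim\nu\}$. $Z(M):=\{(S,ab,cd)\in Z(r,E):Sac,Sbd,Sad,Sbc\in\mathcal{B}\}$ and $[\nu]:=[\overline{\nu}]\cap Z(M)$. For $Z\subseteq Z(M)$, $L(Z)$ is the linear subspace of all $\mu\in\mathbb{R}^{\binom{E}{r}}$ with $\mu(Sac)+\mu(Sbd)=\mu(Sad)+\mu(Sbc)$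 for all $(S,ab,cd)\in Z$ and $\mu(B)=0$ for all $B\notin\mathcal{B}$. -}

module Defs where

open import Data.Nat using (ℕ) renaming (_+_ to _+ℕ_)
open import Data.Bool using (Bool; true; false; T)
open import Data.Unit using (⊤; tt)
open import Data.Empty using (⊥)
open import Data.Maybe using (Maybe; just; nothing)
open import Data.Fin using (Fin)
open import Data.Fin.Subset using (Subset; _∈_; _∉_; ∣_∣; inside; outside)
open import Data.Vec using (_[_]≔_)
open import Data.Product using (Σ; ∃; _×_; _,_)
open import Data.Sum using (_⊎_)
open import Relation.Nullary using (¬_)
open import Relation.Binary.PropositionalEquality using (_≡_)

-- The real numbers, axiomatised as a Dedekind-complete ordered field
-- (unique up to isomorphism, so quantifying over all such models is
-- the same as speaking about ℝ).

record RealField : Set₁ where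
  infixl 6 _+_
  infixl 7 _*_
  infix 4 _≤_
  field
    Carrier : Set
    0# 1#   : Carrier
    _+_ _*_ : Carrier → Carrier → Carrier
    -_      : Carrier → Carrier
    _≤_     : Carrier → Carrier → Set
    +-assoc    : ∀ x y z → (x + y) + z ≡ x + (y + z)
    +-comm     : ∀ x y → x + y ≡ y + x
    +-identity : ∀ x → 0# + x ≡ x
    +-inverse  : ∀ x → x + (- x) ≡ 0#
    *-assoc    : ∀ x y z → (x * y) * z ≡ x * (y * z)
    *-comm     : ∀ x y → x * y ≡ y * x
    *-identity : ∀ x → 1# * x ≡ x
    distrib    : ∀ x y z → x * (y + z) ≡ (x * y) + (x * z)
    0≢1        : ¬ (0# ≡ 1#)
    *-inverse  : ∀ x → ¬ (x ≡ 0#) → ∃ λ y → x * y ≡ 1#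
    ≤-refl     : ∀ x → x ≤ x
    ≤-trans    : ∀ {x y z} → x ≤ y → y ≤ z → x ≤ z
    ≤-antisym  : ∀ {x y} → x ≤ y → y ≤ x → x ≡ y
    ≤-total    : ∀ x y → x ≤ y ⊎ y ≤ x
    +-mono-≤   : ∀ {x y} z → x ≤ y → x + z ≤ y + z
    *-nonneg   : ∀ {x y} → 0# ≤ x → 0# ≤ y → 0# ≤ x * y
    complete   : (P : Carrier → Set) → ∃ P → (∃ λ b → ∀ x → P x → x ≤ b) →
                 ∃ λ s → (∀ x → P x → x ≤ s) ×
                         (∀ b → (∀ x → P x → x ≤ b) → s ≤ b)

record Matroid (n r : ℕ) : Set where
  field
    isBasis   : Subset n → Bool
    nonempty  : ∃ λ B → T (isBasis B)
    rank      : ∀ B → T (isBasis B) → ∣ B ∣ ≡ r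
    exchange  : ∀ B B' → T (isBasis B) → T (isBasis B') →
                ∀ e → e ∈ B → e ∉ B' →
                ∃ λ f → f ∈ B' × f ∉ B ×
                        T (isBasis ((B [ e ]≔ outside) [ f ]≔ inside))

_≐_ : {A : Set} → (A → Set) → (A → Set) → Set
P ≐ Q = ∀ x → (P x → Q x) × (Q x → P x)

-- Quadruples (S, a, b, c, d) encoding the triples (S, ab, cd).
Quad : ℕ → Set
Quad n = Subset n × Fin n × Fin n × Fin n × Fin n

_⊕_⊕_ : ∀ {n} → Subset n → Fin n → Fin n → Subset n
S ⊕ x ⊕ y = (S [ x ]≔ inside) [ y ]≔ inside

InZ : ∀ {n} (r : ℕ) → Quad n → Set
InZ r (S , a , b , c , d) =
  ∣ S ∣ +ℕ 2 ≡ r × a ∉ S × b ∉ S × c ∉ S × d ∉ S ×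
  ¬ a ≡ b × ¬ a ≡ c × ¬ a ≡ d × ¬ b ≡ c × ¬ b ≡ d × ¬ c ≡ d

module Valuations (ℝ : RealField) {n r : ℕ} (M : Matroid n r) where
  open RealField ℝ
  open Matroid M

  Vals : Set
  Vals = (B : Subset n) → T (isBasis B) → Carrier

  -- extended reals ℝ ∪ {∞}; nothing = ∞
  ext : (b : Bool) → (T b → Carrier) → Maybe Carrier
  ext true  f = just (f tt)
  ext false f = nothing

  bar : Vals → Subset n → Maybe Carrier
  bar ν B = ext (isBasis B) (ν B)

  _+∞_ : Maybe Carrier → Maybe Carrier → Maybe Carrier
  just x +∞ just y = just (x + y)
  _      +∞ _      = nothing

  _≥∞_ : Maybe Carrier → Maybe Carrier → Set
  nothing ≥∞ _       = ⊤
  just x  ≥∞ nothing = ⊥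
  just x  ≥∞ just y  = y ≤ x

  IsValuation : Vals → Set
  IsValuation ν = ∀ B B' → ∣ B ∣ ≡ r → ∣ B' ∣ ≡ r → ∀ e → e ∈ B → e ∉ B' →
    ∃ λ f → f ∈ B' × f ∉ B ×
      ((bar ν B +∞ bar ν B') ≥∞
       (bar ν ((B [ e ]≔ outside) [ f ]≔ inside) +∞
        bar ν ((B' [ e ]≔ inside) [ f ]≔ outside)))

  Bracket : Vals → Quad n → Set
  Bracket ν t@(S , a , b , c , d) = InZ r t ×
    (bar ν (S ⊕ a ⊕ c) +∞ bar ν (S ⊕ b ⊕ d) ≡ bar ν (S ⊕ a ⊕ d) +∞ bar ν (S ⊕ b ⊕ c))

  _∼_ : Vals → Vals → Set
  ν ∼ ν' = Bracket ν ≐ Bracket ν'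

  D : Vals → Vals → Set
  D ν ν' = ν' ∼ ν

  InZM : Quad n → Set
  InZM t@(S , a , b , c , d) = InZ r t ×
    T (isBasis (S ⊕ a ⊕ c)) × T (isBasis (S ⊕ b ⊕ d)) ×
    T (isBasis (S ⊕ a ⊕ d)) × T (isBasis (S ⊕ b ⊕ c))

  -- [ν] = [ν̄] ∩ Z(M)
  BracketM : Vals → Quad n → Set
  BracketM ν t = Bracket ν t × InZM t

  -- L(Z) for Z ⊆ Z(M), as a predicate on vectors μ : Subset n → ℝ
  -- (coordinates outside 𝓑, in particular outside (E choose r), are 0)
  L : (Quad n → Set) → (Subset n → Carrier) → Set
  L Z μ = (∀ t → Z t → let (S , a , b , c , d) = t in
              μ (S ⊕ a ⊕ c) + μ (S ⊕ b ⊕ d) ≡ μ (S ⊕ a ⊕ d) + μ (S ⊕ b ⊕ c)) ×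
          (∀ B → ¬ T (isBasis B) → μ B ≡ 0#)

-- A triple t of Z(r,E) lies in [ν̄] either because ν̄ is infinite on both sides of its
-- exchange relation, which depends only on which of the four sets are bases, or because all
-- four sets are bases and ν satisfies the relation at t.  In the second case t ∈ Z(M), and
-- the relation at t holds for ν exactly when the zero extension of ν satisfies it.  That zero
-- extension always lies in L([ν]), so L([ν]) = L([ν′]) forces [ν̄] = [ν̄′].
module Submission where

open import Defs
open import Data.Nat using (ℕ)
open import Data.Bool using (Bool; true; false; T)
open import Data.Unit using (tt)
open import Data.Empty using (⊥-elim)
open import Data.Maybe using (just; nothing)
open import Data.Maybe.Properties using (just-injective)
open import Data.Product using (_×_; _,_; proj₁; proj₂)
open import Data.Fin.Subset using (Subset)
open import Function.Bundles using (_⇔_; mk⇔)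
open import Relation.Nullary using (¬_; yes; no)
open import Relation.Nullary.Decidable using (T?; _×-dec_)
open import Relation.Unary using (_⊆_)
open import Relation.Binary.PropositionalEquality using (_≡_; refl; sym; trans; cong; cong₂)

module _ {A : Set} where

  ≐-refl : (P : A → Set) → P ≐ P
  ≐-refl P x = (λ p → p) , (λ p → p)

  ≐-sym : {P Q : A → Set} → P ≐ Q → Q ≐ P
  ≐-sym P≐Q x = proj₂ (P≐Q x) , proj₁ (P≐Q x)

  ≐-trans : {P Q R : A → Set} → P ≐ Q → Q ≐ R → P ≐ R
  ≐-trans P≐Q Q≐R x = (λ p → proj₁ (Q≐R x) (proj₁ (P≐Q x) p)) ,
                      (λ r → proj₂ (P≐Q x) (proj₂ (Q≐R x) r))

  ≐⇒⊆ : {P Q : A → Set} → P ≐ Q → P ⊆ Q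
  ≐⇒⊆ P≐Q {x} = proj₁ (P≐Q x)

  ⊆-antisym : {P Q : A → Set} → P ⊆ Q → Q ⊆ P → P ≐ Q
  ⊆-antisym P⊆Q Q⊆P x = P⊆Q , Q⊆P

classes-≐⇔ : {A B : Set} (F : A → B → Set) (a a′ : A) →
             ((λ x → F x ≐ F a) ≐ (λ x → F x ≐ F a′)) ⇔ (F a ≐ F a′)
classes-≐⇔ F a a′ = mk⇔ (λ h → proj₁ (h a) (≐-refl (F a)))
                        (λ s x → (λ p → ≐-trans p s) , (λ p → ≐-trans p (≐-sym s)))

module _ (ℝ : RealField) {n r : ℕ} (M : Matroid n r) where
  open RealField ℝ
  open Matroid M
  open Valuations ℝ M

  ext₀ : (b : Bool) → (T b → Carrier) → Carrier
  ext₀ true  f = f tt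
  ext₀ false f = 0#

  extendByZero : Vals → Subset n → Carrier
  extendByZero ν B = ext₀ (isBasis B) (ν B)

  ext₀-false : ∀ b (f : T b → Carrier) → ¬ T b → ext₀ b f ≡ 0#
  ext₀-false true  f ¬t = ⊥-elim (¬t tt)
  ext₀-false false f ¬t = refl

  ext-true : ∀ b (f : T b → Carrier) → T b → ext b f ≡ just (ext₀ b f)
  ext-true true f t = refl

  ext-+∞-nothing : ∀ b b′ (f : T b → Carrier) (f′ : T b′ → Carrier) →
                   ¬ (T b × T b′) → ext b f +∞ ext b′ f′ ≡ nothing
  ext-+∞-nothing true  true  f f′ ¬t = ⊥-elim (¬t (tt , tt))
  ext-+∞-nothing true  false f f′ ¬t = refl
  ext-+∞-nothing false _     f f′ ¬t = refl

  +∞-bases : ∀ ν {B B′} → T (isBasis B) → T (isBasis B′) →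
             bar ν B +∞ bar ν B′ ≡ just (extendByZero ν B + extendByZero ν B′)
  +∞-bases ν {B} {B′} basis basis′ =
    cong₂ _+∞_ (ext-true (isBasis B) (ν B) basis) (ext-true (isBasis B′) (ν B′) basis′)

  +∞-nonbases : ∀ ν {B B′} → ¬ (T (isBasis B) × T (isBasis B′)) → bar ν B +∞ bar ν B′ ≡ nothing
  +∞-nonbases ν {B} {B′} = ext-+∞-nothing (isBasis B) (isBasis B′) (ν B) (ν B′)

  just≢nothing : {x : Carrier} → ¬ (just x ≡ nothing)
  just≢nothing ()

  L-antitone : {Z Z′ : Quad n → Set} → Z ⊆ Z′ → L Z′ ⊆ L Z
  L-antitone Z⊆Z′ (relations , zeros) = (λ t z → relations t (Z⊆Z′ z)) , zeros

  extendByZero∈L : ∀ ν → L (BracketM ν) (extendByZero ν)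
  extendByZero∈L ν = relations , λ B → ext₀-false (isBasis B) (ν B)
    where
    relations : ∀ t → BracketM ν t → let (S , a , b , c , d) = t in
                extendByZero ν (S ⊕ a ⊕ c) + extendByZero ν (S ⊕ b ⊕ d) ≡
                extendByZero ν (S ⊕ a ⊕ d) + extendByZero ν (S ⊕ b ⊕ c)
    relations _ ((_ , eq) , (_ , ac , bd , ad , bc)) =
      just-injective (trans (sym (+∞-bases ν ac bd)) (trans eq (+∞-bases ν ad bc)))

  Bracket⊆-from-L⊇ : ∀ ν ν′ → L (BracketM ν′) ⊆ L (BracketM ν) → Bracket ν ⊆ Bracket ν′
  Bracket⊆-from-L⊇ ν ν′ L⊇ {t@(S , a , b , c , d)} (z , eq)
    with T? (isBasis (S ⊕ a ⊕ c)) ×-dec T? (isBasis (S ⊕ b ⊕ d))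
       | T? (isBasis (S ⊕ a ⊕ d)) ×-dec T? (isBasis (S ⊕ b ⊕ c))
  ... | yes (ac , bd) | yes (ad , bc) =
    z , trans (+∞-bases ν′ ac bd)
              (trans (cong just (proj₁ (L⊇ (extendByZero∈L ν′)) t ((z , eq) , (z , ac , bd , ad , bc))))
                     (sym (+∞-bases ν′ ad bc)))
  ... | yes (ac , bd) | no ¬right =
    ⊥-elim (just≢nothing (trans (sym (+∞-bases ν ac bd)) (trans eq (+∞-nonbases ν ¬right))))
  ... | no ¬left | yes (ad , bc) =
    ⊥-elim (just≢nothing (trans (sym (+∞-bases ν ad bc)) (trans (sym eq) (+∞-nonbases ν ¬left))))
  ... | no ¬left | no ¬right = z , trans (+∞-nonbases ν′ ¬left) (sym (+∞-nonbases ν′ ¬right))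

  ∼⇔L≐ : ∀ ν ν′ → ν ∼ ν′ ⇔ (L (BracketM ν) ≐ L (BracketM ν′))
  ∼⇔L≐ ν ν′ = mk⇔
    (λ ν∼ν′ → ⊆-antisym (L-antitone (BracketM-⊆ ν′ ν (≐-sym ν∼ν′))) (L-antitone (BracketM-⊆ ν ν′ ν∼ν′)))
    (λ L≐ → ⊆-antisym (Bracket⊆-from-L⊇ ν ν′ (≐⇒⊆ (≐-sym L≐))) (Bracket⊆-from-L⊇ ν′ ν (≐⇒⊆ L≐)))
    where
    BracketM-⊆ : ∀ μ μ′ → μ ∼ μ′ → BracketM μ ⊆ BracketM μ′
    BracketM-⊆ μ μ′ μ∼μ′ (t∈[μ] , t∈ZM) = ≐⇒⊆ μ∼μ′ t∈[μ] , t∈ZM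

lemma6 : (ℝ : RealField) {n r : ℕ} (M : Matroid n r)
    (ν ν' : Valuations.Vals ℝ M) →
    Valuations.IsValuation ℝ M ν → Valuations.IsValuation ℝ M ν' →
    ((Valuations.D ℝ M ν ≐ Valuations.D ℝ M ν') ⇔ Valuations._∼_ ℝ M ν ν') ×
    (Valuations._∼_ ℝ M ν ν' ⇔
    (Valuations.L ℝ M (Valuations.BracketM ℝ M ν) ≐
    Valuations.L ℝ M (Valuations.BracketM ℝ M ν')))
lemma6 ℝ M ν ν' _ _ = classes-≐⇔ (Valuations.Bracket ℝ M) ν ν' , ∼⇔L≐ ℝ M ν ν'
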